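{- Let $k\ge 2$. Every P-position $P=(p_1,\dots,p_k)$ of $k$-pile Nim other than $(0,\dots,0)$ has a parent. Moreover, for distinct indices $i,j$ with $p_i,p_j\ge1$, the position obtained from $P$ by subtracting $1$ from $p_i$ and from $p_j$ is a P-position (hence a parent of $P$) if and only if $p_i$ and $p_j$ have the same number of trailing zeros in their binary representations; every parent of $P$ arises in this way.
   Context: A P-position of the game of Nim with $k$ piles is a $k$-tuple $(p_1,\dots,p_k)$ of non-negative integers whose nim-sum $p_1\oplus\cdots\oplus p_k$ is $0$, where $\oplus$ denotes bitwise XOR. For a position $P$, $\#(P)$ is its total number of counters. A P-position $P_1$ is a parent of a P-position $P_2$ if $\#(P_1)+2=\#(P_2)$ and $P_1$ is obtained from $P_2$ by subtracting one counter from each of two distinct piles. -}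

module Defs where

open import Data.Nat using (ℕ; zero; suc; _+_; _∸_; _≥_)
open import Data.Nat using (_*_; _≡ᵇ_)
open import Data.Nat.DivMod using (_/_; _%_)
open import Data.Bool using (if_then_else_)
open import Data.Fin using (Fin)
open import Data.Vec using (Vec; lookup; updateAt; replicate; foldr)
open import Data.Product using (Σ; ∃; _×_)
open import Relation.Binary.PropositionalEquality using (_≡_; _≢_)

-- Bitwise XOR on ℕ, by recursion on the binary digits (m % 2, m / 2).
-- The fuel argument only ensures termination; fuel m + n (≥ number of bits) suffices.
xorF : ℕ → ℕ → ℕ → ℕ
xorF zero m n = 0
xorF (suc f) m n = (if ((m % 2) ≡ᵇ (n % 2)) then 0 else 1) + 2 * xorF f (m / 2) (n / 2)

infixl 6 _⊕_
_⊕_ : ℕ → ℕ → ℕ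
m ⊕ n = xorF (m + n) m n

-- Number of trailing zeros in binary: largest t with 2^t ∣ n (n > 0);
-- for n = 0 the fuel bound gives an arbitrary value (only used for n ≥ 1).
tzF : ℕ → ℕ → ℕ
tzF zero n = 0
tzF (suc f) n = if n % 2 ≡ᵇ 0 then suc (tzF f (n / 2)) else 0

trailingZeros : ℕ → ℕ
trailingZeros n = tzF n n

Position : ℕ → Set
Position k = Vec ℕ k

nimSum : ∀ {k} → Position k → ℕ
nimSum = foldr _ _⊕_ 0

total : ∀ {k} → Position k → ℕ
total = foldr _ _+_ 0

IsPPosition : ∀ {k} → Position k → Set
IsPPosition P = nimSum P ≡ 0

subtractTwo : ∀ {k} → Position k → Fin k → Fin k → Position k
subtractTwo P i j = updateAt (updateAt P i (_∸ 1)) j (_∸ 1)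

IsParent : ∀ {k} → Position k → Position k → Set
IsParent {k} P₁ P₂ =
  IsPPosition P₁ × IsPPosition P₂ × (total P₁ + 2 ≡ total P₂) ×
  Σ (Fin k) λ i → Σ (Fin k) λ j →
    i ≢ j × lookup P₂ i ≥ 1 × lookup P₂ j ≥ 1 × P₁ ≡ subtractTwo P₂ i j

-- A position is a P-position iff every column of binary digits contains an even
-- number of ones. Subtracting one from p > 0 flips exactly the bits 0, …, tz p
-- of p, so subtracting one from the piles p_i and p_j changes the parity of
-- column s by (s ≤ tz p_i) xor (s ≤ tz p_j): the result is again a P-position iff
-- tz p_i = tz p_j. For existence, pick a nonzero pile p_i with the fewest trailing
-- zeros; its bit t = tz p_i is set and column t is even, so another pile p_j has
-- bit t set, whence tz p_j ≤ t, and tz p_j = t by minimality.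
module Submission where

open import Defs
open import Data.Nat using (ℕ; _≥_)
open import Data.Fin using (Fin)
open import Data.Vec using (lookup; replicate)
open import Data.Product using (Σ; ∃; _×_; _,_)
open import Function.Bundles using (_⇔_)
open import Relation.Binary.PropositionalEquality using (_≡_; _≢_)

open import Data.Bool using (Bool; true; false; _xor_; if_then_else_; T)
open import Data.Bool.Properties using (xor-same; xor-identityʳ; xor-assoc)
open import Data.Nat using (zero; suc; _+_; _*_; _∸_; _≤_; _<_; _≮_; z≤n; s≤s; _≡ᵇ_; _≤ᵇ_; _≤?_)
open import Data.Nat.Properties
open import Data.Nat.DivMod
open import Data.Nat.Divisibility using (divides-refl)
open import Data.Fin using (zero; suc)
import Data.Fin.Properties as Fin
open import Data.Vec using (Vec; []; _∷_; updateAt)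
open import Data.Vec.Properties using (lookup∘updateAt′; lookup-replicate)
open import Data.Sum using (_⊎_; inj₁; inj₂)
open import Function using (_∘_)
open import Function.Bundles using (mk⇔; module Equivalence)
open import Relation.Nullary using (yes; no; contradiction)
open import Relation.Binary.PropositionalEquality
  using (refl; sym; trans; cong; cong₂; subst; module ≡-Reasoning)

open ≡-Reasoning

xor-replace : ∀ a c r → c xor r ≡ (a xor r) xor (a xor c)
xor-replace true  true  true  = refl
xor-replace true  true  false = refl
xor-replace true  false true  = refl
xor-replace true  false false = refl
xor-replace false true  true  = refl
xor-replace false true  false = refl
xor-replace false false true  = refl
xor-replace false false false = refl

xor-eliminate : ∀ a b → a xor b ≡ false → a ≡ b
xor-eliminate true  true  _ = refl
xor-eliminate false false _ = refl

-- Not definitional, since _≤ᵇ_ unfolds to the builtin _<ᵇ_.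
suc≤ᵇsuc : ∀ m n → (suc m ≤ᵇ suc n) ≡ (m ≤ᵇ n)
suc≤ᵇsuc zero    n = refl
suc≤ᵇsuc (suc m) n = refl

≤ᵇ-injective : ∀ a b → (∀ s → (s ≤ᵇ a) ≡ (s ≤ᵇ b)) → a ≡ b
≤ᵇ-injective a b same = ≤-antisym (below a b same) (below b a (sym ∘ same))
  where
  below : ∀ a b → (∀ s → (s ≤ᵇ a) ≡ (s ≤ᵇ b)) → a ≤ b
  below a b same = ≤ᵇ⇒≤ a b (subst T (same a) (≤⇒≤ᵇ (≤-refl {a})))

half-≤ : ∀ a f → a * 2 ≤ suc f → a ≤ f
half-≤ zero    f _             = z≤n
half-≤ (suc a) f (s≤s a*2+1≤f) = ≤-trans (s≤s (m≤m*n a 2)) a*2+1≤f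

halves-≤ : ∀ m n f → m + n ≤ suc f → m / 2 + n / 2 ≤ f
halves-≤ m n f m+n≤1+f = half-≤ (m / 2 + n / 2) f
  (≤-trans (≤-reflexive (*-distribʳ-+ 2 (m / 2) (n / 2)))
           (≤-trans (+-mono-≤ (m/n*n≤m m 2) (m/n*n≤m n 2)) m+n≤1+f))

digit : Bool → ℕ
digit false = 0
digit true  = 1

digit-%2 : ∀ b q → (digit b + q * 2) % 2 ≡ digit b
digit-%2 false q = m*n%n≡0 q 2
digit-%2 true  q = [m+kn]%n≡m%n 1 q 2

digit-/2 : ∀ b q → (digit b + q * 2) / 2 ≡ q
digit-/2 b q = trans (+-distrib-/-∣ʳ (digit b) (divides-refl q))
                     (cong₂ _+_ (digit/2≡0 b) (m*n/n≡m q 2))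
  where
  digit/2≡0 : ∀ b → digit b / 2 ≡ 0
  digit/2≡0 false = refl
  digit/2≡0 true  = refl

bit : ℕ → ℕ → Bool
bit zero    n = n % 2 ≡ᵇ 1
bit (suc t) n = bit t (n / 2)

bit-zeroʳ : ∀ t → bit t 0 ≡ false
bit-zeroʳ zero    = refl
bit-zeroʳ (suc t) = bit-zeroʳ t

bit-zero-digit : ∀ b q → bit 0 (digit b + q * 2) ≡ b
bit-zero-digit false q = cong (_≡ᵇ 1) (digit-%2 false q)
bit-zero-digit true  q = cong (_≡ᵇ 1) (digit-%2 true q)

bit-suc-digit : ∀ t b q → bit (suc t) (digit b + q * 2) ≡ bit t q
bit-suc-digit t b q = cong (bit t) (digit-/2 b q)

%2≡digit-bit : ∀ n → n % 2 ≡ digit (bit 0 n)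
%2≡digit-bit n with n % 2 | m%n<n n 2
... | 0 | _ = refl
... | 1 | _ = refl
... | suc (suc _) | s≤s (s≤s ())

binary-expansion : ∀ n → n ≡ digit (bit 0 n) + n / 2 * 2
binary-expansion n = trans (m≡m%n+[m/n]*n n 2) (cong (_+ n / 2 * 2) (%2≡digit-bit n))

bit-extensional : ∀ x y → (∀ t → bit t x ≡ bit t y) → x ≡ y
bit-extensional x y = go (x + y) x y ≤-refl
  where
  go : ∀ f x y → x + y ≤ f → (∀ t → bit t x ≡ bit t y) → x ≡ y
  go zero    zero zero _ _ = refl
  go (suc f) x y x+y≤1+f same = begin
    x                           ≡⟨ binary-expansion x ⟩
    digit (bit 0 x) + x / 2 * 2 ≡⟨ cong₂ (λ b q → digit b + q * 2) (same 0) halves ⟩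
    digit (bit 0 y) + y / 2 * 2 ≡⟨ binary-expansion y ⟨
    y                           ∎
    where
    halves : x / 2 ≡ y / 2
    halves = go f (x / 2) (y / 2) (halves-≤ x y f x+y≤1+f) (same ∘ suc)

xorF-zero : ∀ f → xorF f 0 0 ≡ 0
xorF-zero zero    = refl
xorF-zero (suc f) = cong (2 *_) (xorF-zero f)

xorF-fuel : ∀ f g m n → m + n ≤ f → m + n ≤ g → xorF f m n ≡ xorF g m n
xorF-fuel zero    zero    m    n    _ _ = refl
xorF-fuel zero    (suc g) zero zero _ _ = sym (xorF-zero (suc g))
xorF-fuel (suc f) zero    zero zero _ _ = xorF-zero (suc f)
xorF-fuel (suc f) (suc g) m    n    m+n≤f m+n≤g =
  cong (λ z → (if m % 2 ≡ᵇ n % 2 then 0 else 1) + 2 * z)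
       (xorF-fuel f g (m / 2) (n / 2) (halves-≤ m n f m+n≤f) (halves-≤ m n g m+n≤g))

digit-≡ᵇ : ∀ a b → (if digit a ≡ᵇ digit b then 0 else 1) ≡ digit (a xor b)
digit-≡ᵇ true  true  = refl
digit-≡ᵇ true  false = refl
digit-≡ᵇ false true  = refl
digit-≡ᵇ false false = refl

⊕-unfold : ∀ x y → x ⊕ y ≡ digit (bit 0 x xor bit 0 y) + (x / 2 ⊕ y / 2) * 2
⊕-unfold x y = begin
  xorF (x + y) x y
    ≡⟨ xorF-fuel (x + y) (suc (x + y)) x y ≤-refl (n≤1+n _) ⟩
  (if x % 2 ≡ᵇ y % 2 then 0 else 1) + 2 * xorF (x + y) (x / 2) (y / 2)
    ≡⟨ cong₂ _+_ low (cong (2 *_) high) ⟩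
  digit (bit 0 x xor bit 0 y) + 2 * (x / 2 ⊕ y / 2)
    ≡⟨ cong (digit (bit 0 x xor bit 0 y) +_) (*-comm 2 (x / 2 ⊕ y / 2)) ⟩
  digit (bit 0 x xor bit 0 y) + (x / 2 ⊕ y / 2) * 2
    ∎
  where
  low : (if x % 2 ≡ᵇ y % 2 then 0 else 1) ≡ digit (bit 0 x xor bit 0 y)
  low = trans (cong₂ (λ u v → if u ≡ᵇ v then 0 else 1) (%2≡digit-bit x) (%2≡digit-bit y))
              (digit-≡ᵇ (bit 0 x) (bit 0 y))
  high : xorF (x + y) (x / 2) (y / 2) ≡ x / 2 ⊕ y / 2
  high = xorF-fuel (x + y) (x / 2 + y / 2) (x / 2) (y / 2)
                   (+-mono-≤ (m/n≤m x 2) (m/n≤m y 2)) ≤-refl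

bit-⊕ : ∀ t x y → bit t (x ⊕ y) ≡ bit t x xor bit t y
bit-⊕ zero    x y = trans (cong (bit 0) (⊕-unfold x y)) (bit-zero-digit (bit 0 x xor bit 0 y) (x / 2 ⊕ y / 2))
bit-⊕ (suc t) x y = begin
  bit (suc t) (x ⊕ y)              ≡⟨ cong (bit (suc t)) (⊕-unfold x y) ⟩
  bit (suc t) (digit b + z * 2)    ≡⟨ bit-suc-digit t b z ⟩
  bit t z                          ≡⟨ bit-⊕ t (x / 2) (y / 2) ⟩
  bit t (x / 2) xor bit t (y / 2) ∎
  where
  b : Bool
  b = bit 0 x xor bit 0 y
  z : ℕ
  z = x / 2 ⊕ y / 2

data OddOrEven : ℕ → Set where
  odd  : ∀ q → OddOrEven (1 + q * 2)
  even : ∀ q → OddOrEven (suc q * 2)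

oddOrEven : ∀ p → 1 ≤ p → OddOrEven p
oddOrEven p 1≤p with bit 0 p | p / 2 | binary-expansion p
... | true  | q     | refl = odd q
... | false | suc q | refl = even q
oddOrEven p () | false | zero | refl

tzF-odd : ∀ f q → tzF (suc f) (1 + q * 2) ≡ 0
tzF-odd f q = cong (λ r → if r ≡ᵇ 0 then suc (tzF f ((1 + q * 2) / 2)) else 0) (digit-%2 true q)

tzF-even : ∀ f q → tzF (suc f) (suc q * 2) ≡ suc (tzF f (suc q))
tzF-even f q = cong₂ (λ r h → if r ≡ᵇ 0 then suc (tzF f h) else 0)
                     (digit-%2 false (suc q)) (digit-/2 false (suc q))

tzF-fuel : ∀ f g p → 1 ≤ p → p ≤ f → p ≤ g → tzF f p ≡ tzF g p
tzF-fuel zero    g       (suc p) _ () _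
tzF-fuel (suc f) zero    (suc p) _ _ ()
tzF-fuel (suc f) (suc g) p 1≤p p≤f p≤g with oddOrEven p 1≤p
... | odd q  = trans (tzF-odd f q) (sym (tzF-odd g q))
... | even q = begin
  tzF (suc f) (suc q * 2)  ≡⟨ tzF-even f q ⟩
  suc (tzF f (suc q))      ≡⟨ cong suc (tzF-fuel f g (suc q) (s≤s z≤n) (half-≤ (suc q) f p≤f) (half-≤ (suc q) g p≤g)) ⟩
  suc (tzF g (suc q))      ≡⟨ tzF-even g q ⟨
  tzF (suc g) (suc q * 2)  ∎

trailingZeros-odd : ∀ q → trailingZeros (1 + q * 2) ≡ 0
trailingZeros-odd q = tzF-odd (q * 2) q

trailingZeros-even : ∀ q → trailingZeros (suc q * 2) ≡ suc (trailingZeros (suc q))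
trailingZeros-even q = trans (tzF-even (suc (q * 2)) q)
  (cong suc (tzF-fuel (suc (q * 2)) (suc q) (suc q) (s≤s z≤n) (s≤s (m≤m*n q 2)) ≤-refl))

bit-below-trailingZeros : ∀ s p → 1 ≤ p → s < trailingZeros p → bit s p ≡ false
bit-below-trailingZeros s p 1≤p s<tz with oddOrEven p 1≤p
... | odd q with () ← subst (s <_) (trailingZeros-odd q) s<tz
bit-below-trailingZeros zero    p 1≤p s<tz | even q = bit-zero-digit false (suc q)
bit-below-trailingZeros (suc s) p 1≤p s<tz | even q =
  trans (bit-suc-digit s false (suc q))
        (bit-below-trailingZeros s (suc q) (s≤s z≤n) (≤-pred (subst (suc s <_) (trailingZeros-even q) s<tz)))

bit-trailingZeros : ∀ s p → 1 ≤ p → trailingZeros p ≡ s → bit s p ≡ true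
bit-trailingZeros s p 1≤p tz≡s with oddOrEven p 1≤p
bit-trailingZeros zero    p 1≤p tz≡s | odd q = bit-zero-digit true q
bit-trailingZeros (suc s) p 1≤p tz≡s | odd q with () ← trans (sym (trailingZeros-odd q)) tz≡s
bit-trailingZeros zero    p 1≤p tz≡s | even q with () ← trans (sym (trailingZeros-even q)) tz≡s
bit-trailingZeros (suc s) p 1≤p tz≡s | even q =
  trans (bit-suc-digit s false (suc q))
        (bit-trailingZeros s (suc q) (s≤s z≤n) (suc-injective (trans (sym (trailingZeros-even q)) tz≡s)))

bit⇒positive : ∀ t p → bit t p ≡ true → 1 ≤ p
bit⇒positive t zero    bit≡true with () ← trans (sym (bit-zeroʳ t)) bit≡true
bit⇒positive t (suc p) _ = s≤s z≤n

bit⇒trailingZeros≤ : ∀ t p → bit t p ≡ true → trailingZeros p ≤ t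
bit⇒trailingZeros≤ t zero    bit≡true with () ← trans (sym (bit-zeroʳ t)) bit≡true
bit⇒trailingZeros≤ t (suc p) bit≡true = ≮⇒≥ below
  where
  below : t ≮ trailingZeros (suc p)
  below t<tz with () ← trans (sym bit≡true) (bit-below-trailingZeros t (suc p) (s≤s z≤n) t<tz)

bit-pred : ∀ s p → 1 ≤ p → bit s (p ∸ 1) ≡ bit s p xor (s ≤ᵇ trailingZeros p)
bit-pred s p 1≤p with oddOrEven p 1≤p
bit-pred zero    p 1≤p | odd q = begin
  bit 0 (1 + q * 2 ∸ 1)              ≡⟨ bit-zero-digit false q ⟩
  false                              ≡⟨ cong (_xor true) (bit-zero-digit true q) ⟨
  bit 0 (1 + q * 2) xor true         ∎
bit-pred (suc s) p 1≤p | odd q = begin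
  bit (suc s) (1 + q * 2 ∸ 1)        ≡⟨ bit-suc-digit s false q ⟩
  bit s q                            ≡⟨ xor-identityʳ (bit s q) ⟨
  bit s q xor false                  ≡⟨ cong₂ (λ b t → b xor (suc s ≤ᵇ t))
                                              (bit-suc-digit s true q) (trailingZeros-odd q) ⟨
  bit (suc s) (1 + q * 2) xor (suc s ≤ᵇ trailingZeros (1 + q * 2)) ∎
bit-pred zero    p 1≤p | even q = begin
  bit 0 (suc q * 2 ∸ 1)              ≡⟨ bit-zero-digit true q ⟩
  true                               ≡⟨ cong (_xor true) (bit-zero-digit false (suc q)) ⟨
  bit 0 (suc q * 2) xor true         ∎
bit-pred (suc s) p 1≤p | even q = begin
  bit (suc s) (suc q * 2 ∸ 1)        ≡⟨ bit-suc-digit s true q ⟩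
  bit s q                            ≡⟨ bit-pred s (suc q) (s≤s z≤n) ⟩
  bit s (suc q) xor (s ≤ᵇ trailingZeros (suc q))
    ≡⟨ cong₂ _xor_ (bit-suc-digit s false (suc q))
                   (trans (cong (suc s ≤ᵇ_) (trailingZeros-even q)) (suc≤ᵇsuc s _)) ⟨
  bit (suc s) (suc q * 2) xor (suc s ≤ᵇ trailingZeros (suc q * 2)) ∎

columnParity : ∀ {n} → ℕ → Vec ℕ n → Bool
columnParity t []       = false
columnParity t (x ∷ xs) = bit t x xor columnParity t xs

bit-nimSum : ∀ {n} t (v : Vec ℕ n) → bit t (nimSum v) ≡ columnParity t v
bit-nimSum t []       = bit-zeroʳ t
bit-nimSum t (x ∷ xs) = trans (bit-⊕ t x (nimSum xs)) (cong (bit t x xor_) (bit-nimSum t xs))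

isP⇒columnParity≡false : ∀ {k} t (P : Position k) → IsPPosition P → columnParity t P ≡ false
isP⇒columnParity≡false t P isP = trans (sym (bit-nimSum t P)) (trans (cong (bit t) isP) (bit-zeroʳ t))

columnParity-updateAt : ∀ {n} t (v : Vec ℕ n) i (f : ℕ → ℕ) →
  columnParity t (updateAt v i f) ≡ columnParity t v xor (bit t (lookup v i) xor bit t (f (lookup v i)))
columnParity-updateAt t (x ∷ xs) zero    f = xor-replace (bit t x) (bit t (f x)) (columnParity t xs)
columnParity-updateAt t (x ∷ xs) (suc i) f =
  trans (cong (bit t x xor_) (columnParity-updateAt t xs i f)) (sym (xor-assoc (bit t x) (columnParity t xs) _))

columnParity-updateAt-pred : ∀ {n} s (v : Vec ℕ n) i → 1 ≤ lookup v i →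
  columnParity s (updateAt v i (_∸ 1)) ≡ columnParity s v xor (s ≤ᵇ trailingZeros (lookup v i))
columnParity-updateAt-pred s v i 1≤vi = trans (columnParity-updateAt s v i (_∸ 1))
  (cong (columnParity s v xor_) (begin
    bit s p xor bit s (p ∸ 1)                          ≡⟨ cong (bit s p xor_) (bit-pred s p 1≤vi) ⟩
    bit s p xor (bit s p xor (s ≤ᵇ trailingZeros p))   ≡⟨ xor-assoc (bit s p) _ _ ⟨
    (bit s p xor bit s p) xor (s ≤ᵇ trailingZeros p)   ≡⟨ cong (_xor (s ≤ᵇ trailingZeros p)) (xor-same (bit s p)) ⟩
    s ≤ᵇ trailingZeros p                               ∎))
  where
  p : ℕ
  p = lookup v i

pile-with-bit : ∀ {n} t (v : Vec ℕ n) → columnParity t v ≡ true → ∃ λ j → bit t (lookup v j) ≡ true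
pile-with-bit t (x ∷ xs) parity≡true with bit t x in bit≡true
... | true  = zero , bit≡true
... | false with j , bit-j ← pile-with-bit t xs parity≡true = suc j , bit-j

other-pile-with-bit : ∀ {n} t (v : Vec ℕ n) i → bit t (lookup v i) ≡ true → columnParity t v ≡ false →
  ∃ λ j → j ≢ i × bit t (lookup v j) ≡ true
other-pile-with-bit t (x ∷ xs) zero bit-x parity≡false with columnParity t xs in parity≡true
... | true  with j , bit-j ← pile-with-bit t xs parity≡true = suc j , (λ ()) , bit-j
... | false with () ← trans (sym (cong (_xor false) bit-x)) parity≡false
other-pile-with-bit t (x ∷ xs) (suc i) bit-i parity≡false with bit t x in bit≡true
... | true  = zero , (λ ()) , bit≡true
... | false with j , j≢i , bit-j ← other-pile-with-bit t xs i bit-i parity≡false =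
  suc j , j≢i ∘ Fin.suc-injective , bit-j

total-updateAt-pred : ∀ {n} (v : Vec ℕ n) i → 1 ≤ lookup v i → total (updateAt v i (_∸ 1)) + 1 ≡ total v
total-updateAt-pred (suc x ∷ xs) zero    _    = +-comm (x + total xs) 1
total-updateAt-pred (x ∷ xs)     (suc i) 1≤vi =
  trans (+-assoc x (total (updateAt xs i (_∸ 1))) 1) (cong (x +_) (total-updateAt-pred xs i 1≤vi))

module _ {k} (P : Position k) {i j : Fin k} (i≢j : i ≢ j) (1≤pi : 1 ≤ lookup P i) (1≤pj : 1 ≤ lookup P j) where

  private
    P′ : Position k
    P′ = updateAt P i (_∸ 1)

    lookup-P′-j : lookup P′ j ≡ lookup P j
    lookup-P′-j = lookup∘updateAt′ j i (i≢j ∘ sym) P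

    1≤p′j : 1 ≤ lookup P′ j
    1≤p′j = subst (1 ≤_) (sym lookup-P′-j) 1≤pj

  total-subtractTwo : total (subtractTwo P i j) + 2 ≡ total P
  total-subtractTwo = begin
    total (subtractTwo P i j) + 2        ≡⟨ +-assoc (total (subtractTwo P i j)) 1 1 ⟨
    total (subtractTwo P i j) + 1 + 1    ≡⟨ cong (_+ 1) (total-updateAt-pred P′ j 1≤p′j) ⟩
    total P′ + 1                         ≡⟨ total-updateAt-pred P i 1≤pi ⟩
    total P                              ∎

  bit-nimSum-subtractTwo : IsPPosition P → ∀ s →
    bit s (nimSum (subtractTwo P i j)) ≡ (s ≤ᵇ trailingZeros (lookup P i)) xor (s ≤ᵇ trailingZeros (lookup P j))
  bit-nimSum-subtractTwo isP s = begin
    bit s (nimSum (subtractTwo P i j))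
      ≡⟨ bit-nimSum s (subtractTwo P i j) ⟩
    columnParity s (subtractTwo P i j)
      ≡⟨ columnParity-updateAt-pred s P′ j 1≤p′j ⟩
    columnParity s P′ xor (s ≤ᵇ trailingZeros (lookup P′ j))
      ≡⟨ cong₂ (λ c p → c xor (s ≤ᵇ trailingZeros p)) (columnParity-updateAt-pred s P i 1≤pi) lookup-P′-j ⟩
    (columnParity s P xor (s ≤ᵇ trailingZeros (lookup P i))) xor (s ≤ᵇ trailingZeros (lookup P j))
      ≡⟨ cong (λ c → (c xor (s ≤ᵇ trailingZeros (lookup P i))) xor (s ≤ᵇ trailingZeros (lookup P j)))
              (isP⇒columnParity≡false s P isP) ⟩
    (s ≤ᵇ trailingZeros (lookup P i)) xor (s ≤ᵇ trailingZeros (lookup P j))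
      ∎

  subtractTwo-isP⇔ : IsPPosition P →
    IsPPosition (subtractTwo P i j) ⇔ (trailingZeros (lookup P i) ≡ trailingZeros (lookup P j))
  subtractTwo-isP⇔ isP = mk⇔
    (λ isP′ → ≤ᵇ-injective _ _ λ s → xor-eliminate _ _
      (trans (sym (bit-nimSum-subtractTwo isP s)) (trans (cong (bit s) isP′) (bit-zeroʳ s))))
    (λ tz≡tz → bit-extensional _ 0 λ s → begin
      bit s (nimSum (subtractTwo P i j))
        ≡⟨ bit-nimSum-subtractTwo isP s ⟩
      (s ≤ᵇ trailingZeros (lookup P i)) xor (s ≤ᵇ trailingZeros (lookup P j))
        ≡⟨ cong (λ t → (s ≤ᵇ trailingZeros (lookup P i)) xor (s ≤ᵇ t)) tz≡tz ⟨
      (s ≤ᵇ trailingZeros (lookup P i)) xor (s ≤ᵇ trailingZeros (lookup P i))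
        ≡⟨ xor-same (s ≤ᵇ trailingZeros (lookup P i)) ⟩
      false
        ≡⟨ bit-zeroʳ s ⟨
      bit s 0
        ∎)

  isParent-subtractTwo : IsPPosition P → trailingZeros (lookup P i) ≡ trailingZeros (lookup P j) →
    IsParent (subtractTwo P i j) P
  isParent-subtractTwo isP tz≡tz =
    Equivalence.from (subtractTwo-isP⇔ isP) tz≡tz , isP , total-subtractTwo , i , j , i≢j , 1≤pi , 1≤pj , refl

FewestTrailingZeros : ∀ {n} → Vec ℕ n → Fin n → Set
FewestTrailingZeros v i =
  1 ≤ lookup v i × (∀ l → 1 ≤ lookup v l → trailingZeros (lookup v i) ≤ trailingZeros (lookup v l))

allZero⊎fewestTrailingZeros : ∀ {n} (v : Vec ℕ n) → v ≡ replicate n 0 ⊎ ∃ (FewestTrailingZeros v)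
allZero⊎fewestTrailingZeros [] = inj₁ refl
allZero⊎fewestTrailingZeros (zero ∷ xs) with allZero⊎fewestTrailingZeros xs
... | inj₁ xs≡0                 = inj₁ (cong (0 ∷_) xs≡0)
... | inj₂ (j , 1≤xj , fewest) = inj₂ (suc j , 1≤xj , λ { zero () ; (suc l) → fewest l })
allZero⊎fewestTrailingZeros (suc x ∷ xs) with allZero⊎fewestTrailingZeros xs
... | inj₁ refl = inj₂ (zero , s≤s z≤n , λ
  { zero    _    → ≤-refl
  ; (suc l) 1≤xl → contradiction (subst (1 ≤_) (lookup-replicate l 0) 1≤xl) λ () })
... | inj₂ (j , 1≤xj , fewest) with trailingZeros (suc x) ≤? trailingZeros (lookup xs j)
...   | yes x≤xj = inj₂ (zero , s≤s z≤n , λ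
  { zero    _    → ≤-refl
  ; (suc l) 1≤xl → ≤-trans x≤xj (fewest l 1≤xl) })
...   | no  x≰xj = inj₂ (suc j , 1≤xj , λ
  { zero    _ → ≰⇒≥ x≰xj
  ; (suc l)   → fewest l })

parent-of-fewestTrailingZeros : ∀ {k} (P : Position k) {i} → IsPPosition P → FewestTrailingZeros P i →
  ∃ λ P₁ → IsParent P₁ P
parent-of-fewestTrailingZeros P {i} isP (1≤pi , fewest) =
  parent (other-pile-with-bit t P i (bit-trailingZeros t (lookup P i) 1≤pi refl) (isP⇒columnParity≡false t P isP))
  where
  t : ℕ
  t = trailingZeros (lookup P i)

  parent : (∃ λ j → j ≢ i × bit t (lookup P j) ≡ true) → ∃ λ P₁ → IsParent P₁ P
  parent (j , j≢i , bit-j) = subtractTwo P i j , isParent-subtractTwo P (j≢i ∘ sym) 1≤pi 1≤pj isP tz≡tz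
    where
    1≤pj : 1 ≤ lookup P j
    1≤pj = bit⇒positive t (lookup P j) bit-j
    tz≡tz : t ≡ trailingZeros (lookup P j)
    tz≡tz = ≤-antisym (fewest j 1≤pj) (bit⇒trailingZeros≤ t (lookup P j) bit-j)

lemma21 : (k : ℕ) → k ≥ 2 → (P : Position k) → IsPPosition P →
    (P ≢ replicate k 0 → ∃ λ P₁ → IsParent P₁ P)
    × (∀ (i j : Fin k) → i ≢ j → lookup P i ≥ 1 → lookup P j ≥ 1 →
        (IsPPosition (subtractTwo P i j) ⇔ (trailingZeros (lookup P i) ≡ trailingZeros (lookup P j))))
    × (∀ P₁ → IsParent P₁ P →
        Σ (Fin k) λ i → Σ (Fin k) λ j →
          i ≢ j × lookup P i ≥ 1 × lookup P j ≥ 1 ×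
          trailingZeros (lookup P i) ≡ trailingZeros (lookup P j) × P₁ ≡ subtractTwo P i j)
lemma21 k _ P isP =
  parent-exists ,
  (λ i j i≢j 1≤pi 1≤pj → subtractTwo-isP⇔ P i≢j 1≤pi 1≤pj isP) ,
  parent-is-subtractTwo
  where
  parent-exists : P ≢ replicate k 0 → ∃ λ P₁ → IsParent P₁ P
  parent-exists P≢0 with allZero⊎fewestTrailingZeros P
  ... | inj₁ P≡0           = contradiction P≡0 P≢0
  ... | inj₂ (i , fewest)  = parent-of-fewestTrailingZeros P isP fewest

  parent-is-subtractTwo : ∀ P₁ → IsParent P₁ P → Σ (Fin k) λ i → Σ (Fin k) λ j →
    i ≢ j × lookup P i ≥ 1 × lookup P j ≥ 1 ×
    trailingZeros (lookup P i) ≡ trailingZeros (lookup P j) × P₁ ≡ subtractTwo P i j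
  parent-is-subtractTwo P₁ (isP₁ , _ , _ , i , j , i≢j , 1≤pi , 1≤pj , refl) =
    i , j , i≢j , 1≤pi , 1≤pj , Equivalence.to (subtractTwo-isP⇔ P i≢j 1≤pi 1≤pj isP) isP₁ , refl
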